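{- For all finite sets $\Gamma$ of formulas, all finite multisets $\Delta$ of formulas and every formula $A$: if the sequent $\Gamma;\Delta \vdash A$ is derivable, then $(\Gamma;A) \preceq_s (\Gamma;\Delta)$, where $(\Gamma;A)$ denotes the state with unrestricted part $\Gamma$ and linear part the single formula $A$.
   Context: Formulas: $A,B,C ::= a \mid \mathbf{1} \mid A\otimes B \mid \top \mid A \,\&\, B \mid a \multimap B \mid\ !A$, with $a$ ranging over atomic formulas (the antecedent of $\multimap$ is always atomic). Contexts $\Gamma,\Delta$ are finite multisets of formulas; "$\Delta_1,\Delta_2$" is multiset union, "$\cdot$" the empty context. Sequents $\Gamma;\Delta\vdash A$ are derivable by the following rules (premises before "infer"): (init) $\Gamma;a\vdash a$. (clone) from $\Gamma,A;\Delta,A\vdash C$ infer $\Gamma,A;\Delta\vdash C$. ($\otimes$R) from $\Gamma;\Delta_1\vdash A$ and $\Gamma;\Delta_2\vdash B$ infer $\Gamma;\Delta_1,\Delta_2\vdash A\otimes B$. ($\otimes$L) from $\Gamma;\Delta,A,B\vdash C$ infer $\Gamma;\Delta,A\otimes B\vdash C$. ($\mathbf 1$R) $\Gamma;\cdot\vdash\mathbf 1$. ($\mathbf 1$L) from $\Gamma;\Delta\vdash C$ infer $\Gamma;\Delta,\mathbf 1\vdash C$. ($\&$R) from $\Gamma;\Delta\vdash A$ and $\Gamma;\Delta\vdash B$ infer $\Gamma;\Delta\vdash A\&B$. ($\&$L$_i$, $i=1,2$) from $\Gamma;\Delta,A_i\vdash C$ infer $\Gamma;\Delta,A_1\&A_2\vdash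 C$. ($\top$R) $\Gamma;\Delta\vdash\top$ (there is no left rule for $\top$). ($\multimap$R) from $\Gamma;\Delta,a\vdash B$ infer $\Gamma;\Delta\vdash a\multimap B$. ($\multimap$L) from $\Gamma;\Delta_1\vdash a$ and $\Gamma;\Delta_2,B\vdash C$ infer $\Gamma;\Delta_1,\Delta_2,a\multimap B\vdash C$. (!R) from $\Gamma;\cdot\vdash A$ infer $\Gamma;\cdot\vdash\,!A$. (!L) from $\Gamma,A;\Delta\vdash C$ infer $\Gamma;\Delta,!A\vdash C$. States are pairs $(\Gamma;\Delta)$ considered modulo structural congruence $\equiv$: $\Delta$ is a multiset and $\Gamma$ is a set (i.e. additionally $(\Gamma,A,A;\Delta)\equiv(\Gamma,A;\Delta)$); congruent states are identified. The composition of states is $((\Gamma_1;\Delta_1),(\Gamma_2;\Delta_2)) := (\Gamma_1,\Gamma_2;\Delta_1,\Delta_2)$. Labelled transitions $S\xrightarrow{\beta}S'$ between states, with labels $\beta\in\{\tau\}\cup\{!a\}\cup\{?a\}$ ($a$ atomic), are generated by: $(\Gamma;\Delta,a)\xrightarrow{!a}(\Gamma;\Delta)$; $(\Gamma;\Delta,a\multimap B)\xrightarrow{?a}(\Gamma;\Delta,B)$; if $S_1\xrightarrow{!a}S_1'$ and $S_2\xrightarrow{?a}S_2'$ then $(S_1,S_2)\xrightarrow{\tau}(S_1',S_2')$; $(\Gamma;\Delta,A\otimes B)\xrightarrow{\tau}(\Gamma;\Delta,A,B)$; $(\Gamma;\Delta,\mathbf 1)\xrightarrow{\tau}(\Gamma;\Delta)$;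 $(\Gamma;\Delta,A_1\&A_2)\xrightarrow{\tau}(\Gamma;\Delta,A_i)$ for $i=1,2$; $(\Gamma;\Delta,!A)\xrightarrow{\tau}(\Gamma,A;\Delta)$; $(\Gamma,A;\Delta)\xrightarrow{\tau}(\Gamma,A;\Delta,A)$ (no rule for $\top$). Let $\alpha$ range over non-receive labels ($\tau$ or $!a$). $\overset{\tau}{\Longrightarrow}$ is the reflexive transitive closure of $\xrightarrow{\tau}$, and for $\beta\neq\tau$, $\overset{\beta}{\Longrightarrow}$ is $\overset{\tau}{\Longrightarrow}\xrightarrow{\beta}\overset{\tau}{\Longrightarrow}$. A relation $\mathcal R$ on states is a simulation if $(\Gamma_1;\Delta_1)\mathcal R(\Gamma_2;\Delta_2)$ implies: (1) if $(\Gamma_1;\Delta_1)\equiv(\Gamma_1';\cdot)$ then $(\Gamma_2;\Delta_2)\overset{\tau}{\Longrightarrow}(\Gamma_2';\cdot)$ for some $\Gamma_2'$ with $(\Gamma_1';\cdot)\mathcal R(\Gamma_2';\cdot)$; (2) if $(\Gamma_1;\Delta_1)\equiv((\Gamma_1';\Delta_1'),(\Gamma_1'';\Delta_1''))$ then $(\Gamma_2;\Delta_2)\overset{\tau}{\Longrightarrow}((\Gamma_2';\Delta_2'),(\Gamma_2'';\Delta_2''))$ for some states with $(\Gamma_1';\Delta_1')\mathcal R(\Gamma_2';\Delta_2')$ and $(\Gamma_1'';\Delta_1'')\mathcal R(\Gamma_2'';\Delta_2'')$; (3) if $(\Gamma_1;\Delta_1)\xrightarrow{\alpha}(\Gamma_1';\Delta_1')$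 then $(\Gamma_2;\Delta_2)\overset{\alpha}{\Longrightarrow}(\Gamma_2';\Delta_2')$ for some state with $(\Gamma_1';\Delta_1')\mathcal R(\Gamma_2';\Delta_2')$; (4) if $(\Gamma_1;\Delta_1)\xrightarrow{?a}(\Gamma_1';\Delta_1')$ then $(\Gamma_2;\Delta_2,a)\overset{\tau}{\Longrightarrow}(\Gamma_2';\Delta_2')$ for some state with $(\Gamma_1';\Delta_1')\mathcal R(\Gamma_2';\Delta_2')$. The simulation preorder $\preceq_s$ is the union of all simulations: $S_1\preceq_s S_2$ iff some simulation relates $S_1$ to $S_2$. -}

module Defs where

open import Data.Nat using (ℕ)
open import Data.List using (List; []; _∷_; [_]; _++_)
open import Data.List.Membership.Propositional using (_∈_)
open import Data.List.Relation.Binary.Permutation.Propositional using (_↭_)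
open import Data.Product using (_×_; _,_; Σ; ∃; proj₁; proj₂)
open import Relation.Binary.Construct.Closure.ReflexiveTransitive using (Star)
open import Function.Bundles using (_⇔_)
open import Level using (suc; zero)

Atom : Set
Atom = ℕ

infixr 30 _⊗_
infixr 25 _&_
infixr 20 _⊸_

data Formula : Set where
  atom : Atom → Formula
  𝟏    : Formula
  _⊗_  : Formula → Formula → Formula
  ⊤'   : Formula
  _&_  : Formula → Formula → Formula
  _⊸_  : Atom → Formula → Formula
  !_   : Formula → Formula

-- Contexts are lists; Γ is read as a finite SET (equality = same members),
-- Δ as a finite MULTISET (equality = permutation _↭_).
Ctx : Set
Ctx = List Formula

_≈set_ : Ctx → Ctx → Set
Γ ≈set Γ' = ∀ x → (x ∈ Γ) ⇔ (x ∈ Γ')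

-- Sequent calculus  Γ ; Δ ⊢ C
-- The rule `cong` expresses that sequents are taken up to set (Γ) /
-- multiset (Δ) equality of the contexts.

infix 4 _⨾_⊢_

data _⨾_⊢_ : Ctx → Ctx → Formula → Set where
  cong  : ∀ {Γ Γ' Δ Δ' C} → Γ ≈set Γ' → Δ ↭ Δ' → Γ ⨾ Δ ⊢ C → Γ' ⨾ Δ' ⊢ C
  init  : ∀ {Γ a} → Γ ⨾ [ atom a ] ⊢ atom a
  clone : ∀ {Γ Δ A C} → (A ∷ Γ) ⨾ (A ∷ Δ) ⊢ C → (A ∷ Γ) ⨾ Δ ⊢ C
  ⊗R    : ∀ {Γ Δ₁ Δ₂ A B} → Γ ⨾ Δ₁ ⊢ A → Γ ⨾ Δ₂ ⊢ B → Γ ⨾ (Δ₁ ++ Δ₂) ⊢ A ⊗ B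
  ⊗L    : ∀ {Γ Δ A B C} → Γ ⨾ (A ∷ B ∷ Δ) ⊢ C → Γ ⨾ (A ⊗ B ∷ Δ) ⊢ C
  𝟏R    : ∀ {Γ} → Γ ⨾ [] ⊢ 𝟏
  𝟏L    : ∀ {Γ Δ C} → Γ ⨾ Δ ⊢ C → Γ ⨾ (𝟏 ∷ Δ) ⊢ C
  &R    : ∀ {Γ Δ A B} → Γ ⨾ Δ ⊢ A → Γ ⨾ Δ ⊢ B → Γ ⨾ Δ ⊢ A & B
  &L₁   : ∀ {Γ Δ A₁ A₂ C} → Γ ⨾ (A₁ ∷ Δ) ⊢ C → Γ ⨾ (A₁ & A₂ ∷ Δ) ⊢ C
  &L₂   : ∀ {Γ Δ A₁ A₂ C} → Γ ⨾ (A₂ ∷ Δ) ⊢ C → Γ ⨾ (A₁ & A₂ ∷ Δ) ⊢ C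
  ⊤R    : ∀ {Γ Δ} → Γ ⨾ Δ ⊢ ⊤'
  ⊸R    : ∀ {Γ Δ a B} → Γ ⨾ (atom a ∷ Δ) ⊢ B → Γ ⨾ Δ ⊢ a ⊸ B
  ⊸L    : ∀ {Γ Δ₁ Δ₂ a B C} → Γ ⨾ Δ₁ ⊢ atom a → Γ ⨾ (B ∷ Δ₂) ⊢ C
          → Γ ⨾ (a ⊸ B ∷ Δ₁ ++ Δ₂) ⊢ C
  !R    : ∀ {Γ A} → Γ ⨾ [] ⊢ A → Γ ⨾ [] ⊢ ! A
  !L    : ∀ {Γ Δ A C} → (A ∷ Γ) ⨾ Δ ⊢ C → Γ ⨾ (! A ∷ Δ) ⊢ C

State : Set
State = Ctx × Ctx

infix 4 _≡ₛ_
_≡ₛ_ : State → State → Set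
(Γ , Δ) ≡ₛ (Γ' , Δ') = (Γ ≈set Γ') × (Δ ↭ Δ')

infixr 6 _∥_
_∥_ : State → State → State
(Γ₁ , Δ₁) ∥ (Γ₂ , Δ₂) = (Γ₁ ++ Γ₂ , Δ₁ ++ Δ₂)

data Label : Set where
  τ  : Label
  snd : Atom → Label
  rcv : Atom → Label

data Step : State → Label → State → Set where
  congₛ : ∀ {S T T' S' β} → S ≡ₛ T → Step T β T' → T' ≡ₛ S' → Step S β S'
  send  : ∀ {Γ Δ a} → Step (Γ , atom a ∷ Δ) (snd a) (Γ , Δ)
  recv  : ∀ {Γ Δ a B} → Step (Γ , a ⊸ B ∷ Δ) (rcv a) (Γ , B ∷ Δ)
  comm  : ∀ {S₁ S₁' S₂ S₂' a} → Step S₁ (snd a) S₁' → Step S₂ (rcv a) S₂'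
          → Step (S₁ ∥ S₂) τ (S₁' ∥ S₂')
  tensor : ∀ {Γ Δ A B} → Step (Γ , A ⊗ B ∷ Δ) τ (Γ , A ∷ B ∷ Δ)
  one   : ∀ {Γ Δ} → Step (Γ , 𝟏 ∷ Δ) τ (Γ , Δ)
  with₁ : ∀ {Γ Δ A₁ A₂} → Step (Γ , A₁ & A₂ ∷ Δ) τ (Γ , A₁ ∷ Δ)
  with₂ : ∀ {Γ Δ A₁ A₂} → Step (Γ , A₁ & A₂ ∷ Δ) τ (Γ , A₂ ∷ Δ)
  bang  : ∀ {Γ Δ A} → Step (Γ , ! A ∷ Δ) τ (A ∷ Γ , Δ)
  copy  : ∀ {Γ Δ A} → Step (A ∷ Γ , Δ) τ (A ∷ Γ , A ∷ Δ)

_⇒τ_ : State → State → Set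
S ⇒τ S' = Star (λ X Y → Step X τ Y) S S'

Weak : Label → State → State → Set
Weak τ S S' = S ⇒τ S'
Weak (snd a) S S' = ∃ λ X → ∃ λ Y → S ⇒τ X × Step X (snd a) Y × Y ⇒τ S'
Weak (rcv a) S S' = ∃ λ X → ∃ λ Y → S ⇒τ X × Step X (rcv a) Y × Y ⇒τ S'

data NonReceive : Label → Set where
  nr-τ   : NonReceive τ
  nr-snd : ∀ {a} → NonReceive (snd a)

-- Simulations.  A relation on states (= congruence classes) is represented
-- by a relation on representatives that is closed under ≡ₛ on both sides.

record IsSimulation (R : State → State → Set) : Set where
  field
    respects : ∀ {S₁ S₁' S₂ S₂'} → S₁ ≡ₛ S₁' → S₂ ≡ₛ S₂' → R S₁ S₂ → R S₁' S₂'
    cond₁ : ∀ {S₁ S₂} → R S₁ S₂ → ∀ Γ₁' → S₁ ≡ₛ (Γ₁' , [])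
          → ∃ λ Γ₂' → ∃ λ X → S₂ ⇒τ X × X ≡ₛ (Γ₂' , []) × R (Γ₁' , []) (Γ₂' , [])
    cond₂ : ∀ {S₁ S₂} → R S₁ S₂ → ∀ T₁ T₁' → S₁ ≡ₛ (T₁ ∥ T₁')
          → ∃ λ T₂ → ∃ λ T₂' → ∃ λ X → S₂ ⇒τ X × X ≡ₛ (T₂ ∥ T₂') × R T₁ T₂ × R T₁' T₂'
    cond₃ : ∀ {S₁ S₂} → R S₁ S₂ → ∀ α S₁' → NonReceive α → Step S₁ α S₁'
          → ∃ λ S₂' → Weak α S₂ S₂' × R S₁' S₂'
    cond₄ : ∀ {S₁ S₂} → R S₁ S₂ → ∀ a S₁' → Step S₁ (rcv a) S₁'
          → ∃ λ S₂' → (proj₁ S₂ , atom a ∷ proj₂ S₂) ⇒τ S₂' × R S₁' S₂'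

infix 4 _≼ₛ_
_≼ₛ_ : State → State → Set₁
S₁ ≼ₛ S₂ = Σ (State → State → Set) λ R → IsSimulation R × R S₁ S₂

-- The simulating relation relates S₁ to S₂ when every persistent formula of S₁
-- is derivable from the persistent context of S₂ alone, and the linear context
-- of S₂ splits into pieces, one for each linear formula A of S₁, each piece
-- deriving A.  A derivation of Γ ; Δ ⊢ A relates (Γ ; A) to (Γ ; Δ).
-- The relation is a simulation because the left rules of the calculus are
-- exactly the τ-transitions of states: S₂ can execute the left rules at the
-- root of the derivation of a piece until that derivation ends in a right rule
-- (or init), and the premises of that right rule are pieces for whatever S₁
-- does with the formula (split a ⊗, choose a &, send an atom, receive, ...).

module Submission where

open import Defs
open import Data.List using ([]; _∷_; [_]; _++_)
open import Data.List.Membership.Propositional using (_∈_)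
open import Data.List.Membership.Propositional.Properties using (∈-++⁺ˡ; ∈-++⁺ʳ; ∈-++⁻)
open import Data.List.Relation.Unary.Any using (here; there)
open import Data.List.Relation.Binary.Subset.Propositional using (_⊆_)
open import Data.List.Relation.Binary.Subset.Propositional.Properties
  using (⊆-refl; ⊆-trans; xs⊆x∷xs; ∷⁺ʳ; ∈-∷⁺ʳ; xs⊆xs++ys)
  renaming (++⁺ to ++⁺-⊆)
open import Data.List.Relation.Binary.Permutation.Propositional
  using (_↭_; refl; prep; swap; trans; ↭-refl; ↭-sym; ↭-trans)
open import Data.List.Relation.Binary.Permutation.Propositional.Properties
  using (++⁺ˡ; ++⁺ʳ; ++⁺; shift; shifts; ++-assoc; ++-comm; ++-identityʳ)
open import Data.Product using (_×_; _,_; ∃; ∃₂; proj₁; proj₂)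
open import Data.Sum using ([_,_]′)
open import Data.Unit using (⊤; tt)
open import Function using (id; _∘_)
open import Function.Bundles using (Equivalence; mk⇔)
open import Function.Properties.Equivalence using (⇔-isEquivalence)
open import Relation.Binary.Structures using (IsEquivalence)
import Relation.Binary.PropositionalEquality as ≡
open import Relation.Binary.Construct.Closure.ReflexiveTransitive using (ε; _◅_; _◅◅_; gmap)

private
  module ⇔ {ℓ} = IsEquivalence (⇔-isEquivalence {ℓ})

≈set⇒⊆ : ∀ {Γ Γ'} → Γ ≈set Γ' → Γ ⊆ Γ'
≈set⇒⊆ eq = Equivalence.to (eq _)

⊆-antisym : ∀ {Γ Γ'} → Γ ⊆ Γ' → Γ' ⊆ Γ → Γ ≈set Γ'
⊆-antisym f g x = mk⇔ f g

≈set-refl : ∀ {Γ} → Γ ≈set Γ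
≈set-refl x = ⇔.refl

≈set-sym : ∀ {Γ Γ'} → Γ ≈set Γ' → Γ' ≈set Γ
≈set-sym eq x = ⇔.sym (eq x)

≈set-trans : ∀ {Γ Γ' Γ''} → Γ ≈set Γ' → Γ' ≈set Γ'' → Γ ≈set Γ''
≈set-trans eq eq' x = ⇔.trans (eq x) (eq' x)

∈⇒≈set-∷ : ∀ {A Γ} → A ∈ Γ → Γ ≈set (A ∷ Γ)
∈⇒≈set-∷ {A} {Γ} A∈Γ = ⊆-antisym (xs⊆x∷xs Γ A) (∈-∷⁺ʳ A∈Γ ⊆-refl)

++-cong-≈set : ∀ {Γ₁ Γ₁' Γ₂ Γ₂'} → Γ₁ ≈set Γ₁' → Γ₂ ≈set Γ₂' → (Γ₁ ++ Γ₂) ≈set (Γ₁' ++ Γ₂')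
++-cong-≈set eq₁ eq₂ =
  ⊆-antisym (++⁺-⊆ (≈set⇒⊆ eq₁) (≈set⇒⊆ eq₂))
            (++⁺-⊆ (≈set⇒⊆ (≈set-sym eq₁)) (≈set⇒⊆ (≈set-sym eq₂)))

++-idem-≈set : ∀ Γ → Γ ≈set (Γ ++ Γ)
++-idem-≈set Γ = ⊆-antisym (xs⊆xs++ys Γ Γ) ([ id , id ]′ ∘ ∈-++⁻ Γ)

clone-∈ : ∀ {Γ Δ A C} → A ∈ Γ → Γ ⨾ A ∷ Δ ⊢ C → Γ ⨾ Δ ⊢ C
clone-∈ A∈Γ d =
  cong (≈set-sym (∈⇒≈set-∷ A∈Γ)) ↭-refl (clone (cong (∈⇒≈set-∷ A∈Γ) ↭-refl d))

weaken : ∀ {Γ Γ' Δ C} → Γ ⊆ Γ' → Γ ⨾ Δ ⊢ C → Γ' ⨾ Δ ⊢ C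
weaken f (cong eq p d) = cong ≈set-refl p (weaken (f ∘ ≈set⇒⊆ eq) d)
weaken f init          = init
weaken f (clone d)     = clone-∈ (f (here ≡.refl)) (weaken f d)
weaken f (⊗R d e)      = ⊗R (weaken f d) (weaken f e)
weaken f (⊗L d)        = ⊗L (weaken f d)
weaken f 𝟏R            = 𝟏R
weaken f (𝟏L d)        = 𝟏L (weaken f d)
weaken f (&R d e)      = &R (weaken f d) (weaken f e)
weaken f (&L₁ d)       = &L₁ (weaken f d)
weaken f (&L₂ d)       = &L₂ (weaken f d)
weaken f ⊤R            = ⊤R
weaken f (⊸R d)        = ⊸R (weaken f d)
weaken f (⊸L d e)      = ⊸L (weaken f d) (weaken f e)
weaken f (!R d)        = !R (weaken f d)
weaken f (!L d)        = !L (weaken (∷⁺ʳ _ f) d)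

identity : ∀ Γ A → Γ ⨾ [ A ] ⊢ A
identity Γ (atom a) = init
identity Γ 𝟏        = 𝟏L 𝟏R
identity Γ (A ⊗ B)  = ⊗L (⊗R (identity Γ A) (identity Γ B))
identity Γ ⊤'       = ⊤R
identity Γ (A & B)  = &R (&L₁ (identity Γ A)) (&L₂ (identity Γ B))
identity Γ (a ⊸ B)  = ⊸R (cong ≈set-refl (swap _ _ ↭-refl) (⊸L init (identity Γ B)))
identity Γ (! A)    = !L (!R (clone-∈ (here ≡.refl) (identity (A ∷ Γ) A)))

≡ₛ-refl : ∀ {S} → S ≡ₛ S
≡ₛ-refl = ≈set-refl , ↭-refl

≡ₛ-sym : ∀ {S T} → S ≡ₛ T → T ≡ₛ S
≡ₛ-sym (eq , p) = ≈set-sym eq , ↭-sym p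

≡ₛ-trans : ∀ {S T U} → S ≡ₛ T → T ≡ₛ U → S ≡ₛ U
≡ₛ-trans (eq , p) (eq' , p') = ≈set-trans eq eq' , ↭-trans p p'

∥-cong : ∀ {S S' T T'} → S ≡ₛ S' → T ≡ₛ T' → (S ∥ T) ≡ₛ (S' ∥ T')
∥-cong (eq , p) (eq' , p') = ++-cong-≈set eq eq' , ++⁺ p p'

copy-∈ : ∀ {Γ Δ A} → A ∈ Γ → Step (Γ , Δ) τ (Γ , A ∷ Δ)
copy-∈ A∈Γ = congₛ (∈⇒≈set-∷ A∈Γ , ↭-refl) copy (≈set-sym (∈⇒≈set-∷ A∈Γ) , ↭-refl)

comm-step : ∀ {Γ Δ a B} → Step (Γ , atom a ∷ a ⊸ B ∷ Δ) τ (Γ , B ∷ Δ)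
comm-step = comm (send {Γ = []} {Δ = []}) recv

step-frameʳ : ∀ {Γ Δ Γ' Δ' β} F → Step (Γ , Δ) β (Γ' , Δ') → Step (Γ , Δ ++ F) β (Γ' , Δ' ++ F)
step-frameʳ F (congₛ (eq , p) s (eq' , p')) = congₛ (eq , ++⁺ʳ F p) (step-frameʳ F s) (eq' , ++⁺ʳ F p')
step-frameʳ F send   = send
step-frameʳ F recv   = recv
step-frameʳ F (comm {S₁ = _ , Δ₁} {S₁' = _ , Δ₁'} {S₂ = _ , Δ₂} {S₂' = _ , Δ₂'} s r) =
  congₛ (≈set-refl , ++-assoc Δ₁ Δ₂ F) (comm s (step-frameʳ F r))
        (≈set-refl , ↭-sym (++-assoc Δ₁' Δ₂' F))
step-frameʳ F tensor = tensor
step-frameʳ F one    = one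
step-frameʳ F with₁  = with₁
step-frameʳ F with₂  = with₂
step-frameʳ F bang   = bang
step-frameʳ F copy   = copy

send-inv : ∀ {S a S'} → Step S (snd a) S' → ∃₂ λ Γ Δ → S ≡ₛ (Γ , atom a ∷ Δ) × (Γ , Δ) ≡ₛ S'
send-inv (congₛ e s e') with send-inv s
... | Γ , Δ , e₁ , e₂ = Γ , Δ , ≡ₛ-trans e e₁ , ≡ₛ-trans e₂ e'
send-inv send = _ , _ , ≡ₛ-refl , ≡ₛ-refl

recv-inv : ∀ {S a S'} → Step S (rcv a) S'
         → ∃₂ λ Γ Δ → ∃ λ B → S ≡ₛ (Γ , a ⊸ B ∷ Δ) × (Γ , B ∷ Δ) ≡ₛ S'
recv-inv (congₛ e s e') with recv-inv s
... | Γ , Δ , B , e₁ , e₂ = Γ , Δ , B , ≡ₛ-trans e e₁ , ≡ₛ-trans e₂ e'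
recv-inv recv = _ , _ , _ , ≡ₛ-refl , ≡ₛ-refl

comm-inv : ∀ {S₁ S₁' S₂ S₂' a} → Step S₁ (snd a) S₁' → Step S₂ (rcv a) S₂'
         → ∃₂ λ Γ Δ → ∃ λ B → (S₁ ∥ S₂) ≡ₛ (Γ , atom a ∷ a ⊸ B ∷ Δ) × (Γ , B ∷ Δ) ≡ₛ (S₁' ∥ S₂')
comm-inv s s' with send-inv s | recv-inv s'
... | _ , Δ , e₁ , e₂ | _ , Δ' , B , e₁' , e₂' =
  _ , _ , B , ≡ₛ-trans (∥-cong e₁ e₁') (≈set-refl , prep _ (shift _ Δ Δ'))
            , ≡ₛ-trans (≈set-refl , ↭-sym (shift B Δ Δ')) (∥-cong e₂ e₂')

infix 3 _⇛_
_⇛_ : State → State → Set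
S ⇛ T = ∃ λ X → S ⇒τ X × X ≡ₛ T

⇛-refl : ∀ {S} → S ⇛ S
⇛-refl = _ , ε , ≡ₛ-refl

≡ₛ-⇛ : ∀ {S S' T} → S ≡ₛ S' → S' ⇛ T → S ⇛ T
≡ₛ-⇛ e (_ , ε , e')      = _ , ε , ≡ₛ-trans e e'
≡ₛ-⇛ e (X , s ◅ ss , e') = X , congₛ e s ≡ₛ-refl ◅ ss , e'

⇛-≡ₛ : ∀ {S T U} → S ⇛ T → T ≡ₛ U → S ⇛ U
⇛-≡ₛ (X , ss , e) e' = X , ss , ≡ₛ-trans e e'

⇛-trans : ∀ {S T U} → S ⇛ T → T ⇛ U → S ⇛ U
⇛-trans (X , ss , e) T⇛U with ≡ₛ-⇛ e T⇛U
... | Y , ss' , e' = Y , ss ◅◅ ss' , e'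

step-⇛ : ∀ {S T} → Step S τ T → S ⇛ T
step-⇛ s = _ , s ◅ ε , ≡ₛ-refl

⇛-frameʳ : ∀ F {Γ Δ Γ' Δ'} → (Γ , Δ) ⇛ (Γ' , Δ') → (Γ , Δ ++ F) ⇛ (Γ' , Δ' ++ F)
⇛-frameʳ F (X , ss , eq , p) = (proj₁ X , proj₂ X ++ F) , gmap _ (step-frameʳ F) ss , eq , ++⁺ʳ F p

⇛-frameˡ : ∀ F {Γ Δ Γ' Δ'} → (Γ , Δ) ⇛ (Γ' , Δ') → (Γ , F ++ Δ) ⇛ (Γ' , F ++ Δ')
⇛-frameˡ F {Δ = Δ} {Δ' = Δ'} m =
  ≡ₛ-⇛ (≈set-refl , ++-comm F Δ) (⇛-≡ₛ (⇛-frameʳ F m) (≈set-refl , ++-comm Δ' F))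

RightRule : Ctx → Ctx → Formula → Set
RightRule Γ D (atom a) = D ↭ [ atom a ]
RightRule Γ D 𝟏        = D ↭ []
RightRule Γ D (A ⊗ B)  = ∃₂ λ D₁ D₂ → D ↭ D₁ ++ D₂ × Γ ⨾ D₁ ⊢ A × Γ ⨾ D₂ ⊢ B
RightRule Γ D ⊤'       = ⊤
RightRule Γ D (A & B)  = Γ ⨾ D ⊢ A × Γ ⨾ D ⊢ B
RightRule Γ D (a ⊸ B)  = Γ ⨾ atom a ∷ D ⊢ B
RightRule Γ D (! A)    = D ↭ [] × Γ ⨾ [] ⊢ A

ReducesToRightRule : Ctx → Ctx → Formula → Set
ReducesToRightRule Γ Δ A =
  ∃₂ λ Γ' D → (Γ , Δ) ⇛ (Γ' , D) × Γ ⊆ Γ' × RightRule Γ' D A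

reduces-now : ∀ {Γ Δ} A → RightRule Γ Δ A → ReducesToRightRule Γ Δ A
reduces-now A r = _ , _ , ⇛-refl , ⊆-refl , r

reduces-after : ∀ {Γ Δ Γ' Δ' A} → (Γ , Δ) ⇛ (Γ' , Δ') → Γ ⊆ Γ'
              → ReducesToRightRule Γ' Δ' A → ReducesToRightRule Γ Δ A
reduces-after m f (Γ'' , D , m' , g , r) = Γ'' , D , ⇛-trans m m' , ⊆-trans f g , r

reduces-after-τ : ∀ {Γ Δ Δ' A} → Step (Γ , Δ) τ (Γ , Δ')
                → ReducesToRightRule Γ Δ' A → ReducesToRightRule Γ Δ A
reduces-after-τ s = reduces-after (step-⇛ s) ⊆-refl

-- Generalised to Γ ⊆ Γ₂ because running the left rules of one premise enlarges the
-- persistent context seen by the next (!L followed by ⊸L).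
run-left-rules : ∀ {Γ Δ A Γ₂} → Γ ⨾ Δ ⊢ A → Γ ⊆ Γ₂ → ReducesToRightRule Γ₂ Δ A
run-left-rules (cong eq p d) f =
  reduces-after (_ , ε , ≈set-refl , ↭-sym p) ⊆-refl (run-left-rules d (f ∘ ≈set⇒⊆ eq))
run-left-rules (clone d) f = reduces-after-τ (copy-∈ (f (here ≡.refl))) (run-left-rules d f)
run-left-rules (⊗L d)    f = reduces-after-τ tensor (run-left-rules d f)
run-left-rules (𝟏L d)    f = reduces-after-τ one (run-left-rules d f)
run-left-rules (&L₁ d)   f = reduces-after-τ with₁ (run-left-rules d f)
run-left-rules (&L₂ d)   f = reduces-after-τ with₂ (run-left-rules d f)
run-left-rules (!L d)    f = reduces-after (step-⇛ bang) (xs⊆x∷xs _ _) (run-left-rules d (∷⁺ʳ _ f))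
run-left-rules (⊸L {Δ₂ = Δ₂} {a = a} {B = B} d e) f with run-left-rules d f
... | _ , _ , m , g , D↭a =
  reduces-after (⇛-trans (⇛-frameˡ [ a ⊸ B ] (⇛-frameʳ Δ₂ m))
                         (≡ₛ-⇛ (≈set-refl , ↭-trans (prep _ (++⁺ʳ Δ₂ D↭a)) (swap _ _ ↭-refl))
                               (step-⇛ comm-step)))
                g (run-left-rules e (⊆-trans f g))
run-left-rules {A = A} init     f = reduces-now A ↭-refl
run-left-rules {A = A} 𝟏R       f = reduces-now A ↭-refl
run-left-rules {A = A} ⊤R       f = reduces-now A tt
run-left-rules {A = A} (⊗R d e) f = reduces-now A (_ , _ , ↭-refl , weaken f d , weaken f e)
run-left-rules {A = A} (&R d e) f = reduces-now A (weaken f d , weaken f e)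
run-left-rules {A = A} (⊸R d)   f = reduces-now A (weaken f d)
run-left-rules {A = A} (!R d)   f = reduces-now A (↭-refl , weaken f d)

infixr 5 _∷_
data Pieces (Γ : Ctx) : Ctx → Ctx → Set where
  []  : Pieces Γ [] []
  _∷_ : ∀ {D A Δ X} → Γ ⨾ D ⊢ A → Pieces Γ Δ X → Pieces Γ (A ∷ Δ) (D ++ X)

Pieces-weaken : ∀ {Γ Γ' Δ X} → Γ ⊆ Γ' → Pieces Γ Δ X → Pieces Γ' Δ X
Pieces-weaken f []       = []
Pieces-weaken f (d ∷ ds) = weaken f d ∷ Pieces-weaken f ds

Pieces-resp-↭ : ∀ {Γ Δ Δ' X} → Δ ↭ Δ' → Pieces Γ Δ X → ∃ λ Y → X ↭ Y × Pieces Γ Δ' Y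
Pieces-resp-↭ refl ds = _ , ↭-refl , ds
Pieces-resp-↭ (prep _ p) (_∷_ {D = D} d ds) with Pieces-resp-↭ p ds
... | Y , q , ds' = D ++ Y , ++⁺ˡ D q , d ∷ ds'
Pieces-resp-↭ (swap _ _ p) (_∷_ {D = D₁} d₁ (_∷_ {D = D₂} d₂ ds)) with Pieces-resp-↭ p ds
... | Y , q , ds' = D₂ ++ D₁ ++ Y , ↭-trans (++⁺ˡ D₁ (++⁺ˡ D₂ q)) (shifts D₁ D₂) , d₂ ∷ d₁ ∷ ds'
Pieces-resp-↭ (trans p p') ds with Pieces-resp-↭ p ds
... | Y , q , ds' with Pieces-resp-↭ p' ds'
...   | Z , q' , ds'' = Z , ↭-trans q q' , ds''

Pieces-++⁻ : ∀ {Γ} Δ {Δ' X} → Pieces Γ (Δ ++ Δ') X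
           → ∃₂ λ Y Y' → X ↭ Y ++ Y' × Pieces Γ Δ Y × Pieces Γ Δ' Y'
Pieces-++⁻ []      ds = [] , _ , ↭-refl , [] , ds
Pieces-++⁻ (A ∷ Δ) (_∷_ {D = D} d ds) with Pieces-++⁻ Δ ds
... | Y , Y' , q , ds₁ , ds₂ = D ++ Y , Y' , ↭-trans (++⁺ˡ D q) (↭-sym (++-assoc D Y Y')) , d ∷ ds₁ , ds₂

infix 4 _⨾·⊢_
_⨾·⊢_ : Ctx → Ctx → Set
Γ ⨾·⊢ Γ' = ∀ {B} → B ∈ Γ' → Γ ⨾ [] ⊢ B

infix 4 _≲_
record _≲_ (S₁ S₂ : State) : Set where
  constructor mk≲
  field
    {pieces}   : Ctx
    linear     : proj₂ S₂ ↭ pieces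
    split      : Pieces (proj₁ S₂) (proj₂ S₁) pieces
    persistent : proj₁ S₂ ⨾·⊢ proj₁ S₁

≲-weaken : ∀ {S₁ Γ₂ Γ₂' Δ₂} → Γ₂ ⊆ Γ₂' → S₁ ≲ (Γ₂ , Δ₂) → S₁ ≲ (Γ₂' , Δ₂)
≲-weaken f (mk≲ q ds gc) = mk≲ q (Pieces-weaken f ds) (weaken f ∘ gc)

≲-respˡ : ∀ {S₁ S₁' S₂} → S₁ ≡ₛ S₁' → S₁ ≲ S₂ → S₁' ≲ S₂
≲-respˡ (eq , p) (mk≲ q ds gc) with Pieces-resp-↭ p ds
... | Y , q' , ds' = mk≲ (↭-trans q q') ds' (gc ∘ ≈set⇒⊆ (≈set-sym eq))

≲-respʳ : ∀ {S₁ S₂ S₂'} → S₂ ≡ₛ S₂' → S₁ ≲ S₂ → S₁ ≲ S₂'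
≲-respʳ (eq , p) (mk≲ q ds gc) = ≲-weaken (≈set⇒⊆ eq) (mk≲ (↭-trans (↭-sym p) q) ds gc)

≲-∷ : ∀ {Γ Δ Γ₂ D E A} → Γ₂ ⨾ D ⊢ A → (Γ , Δ) ≲ (Γ₂ , E) → (Γ , A ∷ Δ) ≲ (Γ₂ , D ++ E)
≲-∷ {D = D} d (mk≲ q ds gc) = mk≲ (++⁺ˡ D q) (d ∷ ds) gc

≲-! : ∀ {Γ Δ Γ₂ E A} → Γ₂ ⨾ [] ⊢ A → (Γ , Δ) ≲ (Γ₂ , E) → (A ∷ Γ , Δ) ≲ (Γ₂ , E)
≲-! d (mk≲ q ds gc) = mk≲ q ds λ { (here ≡.refl) → d ; (there B∈Γ) → gc B∈Γ }

≲-prepend : ∀ {S₁ Γ₂ D E} → D ↭ [] → S₁ ≲ (Γ₂ , E) → S₁ ≲ (Γ₂ , D ++ E)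
≲-prepend {E = E} p = ≲-respʳ (≈set-refl , ↭-sym (++⁺ʳ E p))

derivation-≲ : ∀ {Γ Δ A} → Γ ⨾ Δ ⊢ A → (Γ , [ A ]) ≲ (Γ , Δ)
derivation-≲ {Γ} {Δ} d =
  mk≲ (↭-sym (++-identityʳ Δ)) (d ∷ []) (λ B∈Γ → clone-∈ B∈Γ (identity Γ _))

record Focused (Γ : Ctx) (A : Formula) (Δ : Ctx) (S₂ : State) : Set where
  constructor focused
  field
    {Γ₂ D E} : Ctx
    reduce   : S₂ ⇛ (Γ₂ , D ++ E)
    right    : RightRule Γ₂ D A
    rest     : (Γ , Δ) ≲ (Γ₂ , E)

focus : ∀ {Γ A Δ S₂} → (Γ , A ∷ Δ) ≲ S₂ → Focused Γ A Δ S₂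
focus (mk≲ q (_∷_ {X = E} d ds) gc) with run-left-rules d ⊆-refl
... | _ , _ , m , f , r =
  focused (≡ₛ-⇛ (≈set-refl , q) (⇛-frameʳ E m)) r (≲-weaken f (mk≲ ↭-refl ds gc))

τ-Answer : State → State → Set
τ-Answer S₁' S₂ = ∃ λ S₂' → S₂ ⇒τ S₂' × S₁' ≲ S₂'

τ-answer : ∀ {S₁' S₂ T} → S₂ ⇛ T → S₁' ≲ T → τ-Answer S₁' S₂
τ-answer (X , ss , e) r = X , ss , ≲-respʳ (≡ₛ-sym e) r

-- The atom's piece is the atom itself, which completes the premise a ∷ D₂ ⊢ B of ⊸R: no cut.
simulate-comm : ∀ {Γ Δ a B S₂} → (Γ , atom a ∷ a ⊸ B ∷ Δ) ≲ S₂ → τ-Answer (Γ , B ∷ Δ) S₂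
simulate-comm r with focus r
... | focused {D = D₁} m₁ D₁↭a r₁ with focus r₁
...   | focused {D = D₂} {E = E₂} m₂ d r₂ =
  τ-answer (⇛-trans m₁ (⇛-frameˡ D₁ m₂))
           (≲-respʳ (≈set-refl , ++-assoc D₁ D₂ E₂)
                    (≲-∷ (cong ≈set-refl (++⁺ʳ D₂ (↭-sym D₁↭a)) d) r₂))

simulate-τ : ∀ {S₁ S₁' S₂} → Step S₁ τ S₁' → S₁ ≲ S₂ → τ-Answer S₁' S₂
simulate-τ (congₛ e s e') r with simulate-τ s (≲-respˡ e r)
... | S₂' , ss , r' = S₂' , ss , ≲-respˡ e' r'
simulate-τ (comm s s') r with comm-inv s s'
... | _ , _ , _ , e , e' with simulate-comm (≲-respˡ e r)
...   | S₂' , ss , r' = S₂' , ss , ≲-respˡ e' r'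
simulate-τ tensor r with focus r
... | focused {E = E} m (D₁ , D₂ , p , d₁ , d₂) r' =
  τ-answer m (≲-respʳ (≈set-refl , ↭-sym (↭-trans (++⁺ʳ E p) (++-assoc D₁ D₂ E)))
                      (≲-∷ d₁ (≲-∷ d₂ r')))
simulate-τ one r with focus r
... | focused m p r' = τ-answer m (≲-prepend p r')
simulate-τ with₁ r with focus r
... | focused m (d₁ , d₂) r' = τ-answer m (≲-∷ d₁ r')
simulate-τ with₂ r with focus r
... | focused m (d₁ , d₂) r' = τ-answer m (≲-∷ d₂ r')
simulate-τ bang r with focus r
... | focused m (p , d) r' = τ-answer m (≲-prepend p (≲-! d r'))
simulate-τ {S₂ = S₂} copy (mk≲ q ds gc) = S₂ , ε , mk≲ q (gc (here ≡.refl) ∷ ds) gc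

simulate-snd : ∀ {S₁ S₁' S₂ a} → Step S₁ (snd a) S₁' → S₁ ≲ S₂
             → ∃ λ S₂' → Weak (snd a) S₂ S₂' × S₁' ≲ S₂'
simulate-snd s r with send-inv s
... | _ , _ , e₁ , e₂ with focus (≲-respˡ e₁ r)
...   | focused {Γ₂ = Γ₂} {E = E} (X , ss , e) D↭a r' =
  (Γ₂ , E) , (X , (Γ₂ , E) , ss , congₛ (≡ₛ-trans e (≈set-refl , ++⁺ʳ E D↭a)) send ≡ₛ-refl , ε)
  , ≲-respˡ e₂ r'

simulate-rcv : ∀ {S₁ S₁' S₂ a} → Step S₁ (rcv a) S₁' → S₁ ≲ S₂
             → τ-Answer S₁' (proj₁ S₂ , atom a ∷ proj₂ S₂)
simulate-rcv {a = a} s r with recv-inv s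
... | _ , _ , _ , e₁ , e₂ with focus (≲-respˡ e₁ r)
...   | focused m d r' = τ-answer (⇛-frameˡ [ atom a ] m) (≲-respˡ e₂ (≲-∷ d r'))

≲-isSimulation : IsSimulation _≲_
≲-isSimulation = record
  { respects = λ e e' → ≲-respʳ e' ∘ ≲-respˡ e
  ; cond₁    = terminal
  ; cond₂    = parallel
  ; cond₃    = λ { r _ _ nr-τ s → simulate-τ s r ; r _ _ nr-snd s → simulate-snd s r }
  ; cond₄    = λ r _ _ s → simulate-rcv s r
  }
  where
  terminal : ∀ {S₁ S₂} → S₁ ≲ S₂ → ∀ Γ₁ → S₁ ≡ₛ (Γ₁ , [])
           → ∃ λ Γ₂ → ∃ λ X → S₂ ⇒τ X × X ≡ₛ (Γ₂ , []) × (Γ₁ , []) ≲ (Γ₂ , [])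
  terminal {S₂ = S₂} r _ e with ≲-respˡ e r
  ... | mk≲ q [] gc = proj₁ S₂ , S₂ , ε , (≈set-refl , q) , mk≲ ↭-refl [] gc

  parallel : ∀ {S₁ S₂} → S₁ ≲ S₂ → ∀ T₁ T₁' → S₁ ≡ₛ (T₁ ∥ T₁')
           → ∃ λ T₂ → ∃ λ T₂' → ∃ λ X → S₂ ⇒τ X × X ≡ₛ (T₂ ∥ T₂') × T₁ ≲ T₂ × T₁' ≲ T₂'
  parallel {S₂ = Γ₂ , Δ₂} r (Γ , Δ) _ e with ≲-respˡ e r
  ... | mk≲ q ds gc with Pieces-++⁻ Δ ds
  ...   | Y , Y' , q' , ds₁ , ds₂ =
    (Γ₂ , Y) , (Γ₂ , Y') , (Γ₂ , Δ₂) , ε , (++-idem-≈set Γ₂ , ↭-trans q q')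
    , mk≲ ↭-refl ds₁ (gc ∘ ∈-++⁺ˡ) , mk≲ ↭-refl ds₂ (gc ∘ ∈-++⁺ʳ Γ)

theorem2 : ∀ (Γ Δ : Ctx) (A : Formula) → Γ ⨾ Δ ⊢ A → (Γ , [ A ]) ≼ₛ (Γ , Δ)
theorem2 Γ Δ A d = _≲_ , ≲-isSimulation , derivation-≲ d
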